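{- Let $b\ge3$ be odd and let $a=a(b,i)$ be the $i$-th input of the complete MDS system. Let $\Sigma(b,i)$ be the Hilton–Pedersen coach with input $a_1=a$, with upper row $(a_1,\dots,a_r)$, lower row $(k_1,\dots,k_r)$, and $k(b)=k_1+\dots+k_r$. Modified coach symbol: - Put $a_{r+1}=a_1$ and $cy_j=a_{r+2-j}$ for $j=1,\dots,r+1$ (so $cy_1=cy_{r+1}=a_1$). - Put $ly_j=k_{r+1-j}$ for $j=1,\dots,r$, and $s_j=\sum_{q=1}^{j}ly_q$ with $s_0=0$. Extended list: define $EMCSy(b,i)=(n_0,n_1,\dots,n_{k(b)})$ by - $n_{s_j+p}=2^{p}\,cy_{j+1}$ for $j=0,\dots,r-1$ and $p=0,1,\dots,ly_{j+1}-1$; - $n_{k(b)}=cy_1$. Then $(n_1,n_2,\dots,n_{k(b)})$, i.e. $EMCSy(b,i)$ without its first entry $n_0=a$, equals the cycle $MDS(b,i)=\big(\mathrm{mod}^*(a2^j,b)\big)_{j=1}^{P(b)}$.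
   Context: For odd $b\ge3$: - $RRS^*(b)=\{r\in\mathbb Z:1\le r\le(b-1)/2,\ \gcd(r,b)=1\}$. - For $m$ coprime to $b$, $\mathrm{mod}^*(m,b)=\mathrm{mod}(m,b)$ if the least non-negative residue $\mathrm{mod}(m,b)$ is $\le b/2$, and $\mathrm{mod}^*(m,b)=\mathrm{mod}(-m,b)$ otherwise. - MDS inputs: $a(b,1)=1$, and $a(b,i+1)$ is the smallest odd element of $RRS^*(b)$ not occurring in the sequences with earlier inputs. - $MDS(b,i)$ is the primitive period, of length $P(b)$, of $(\mathrm{mod}^*(a(b,i)2^j,b))_{j\ge1}$. - Coach with odd input $a_1<b/2$ coprime to $b$: $a_{j+1}=(b-a_j)/2^{k_j}$, where $k_j$ is the $2$-adic valuation of $b-a_j$, and $r$ is the least $r\ge1$ with $a_{r+1}=a_1$. -}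

module Defs where

open import Data.Nat using (ℕ; zero; suc; _+_; _*_; _∸_; _^_; _≤_; _<_; _≤?_)
open import Data.Nat.Properties using (m^n≢0)
open import Data.Nat.DivMod using (_%_; _/_)
open import Data.Nat.GCD using (gcd)
open import Data.List using (List; []; _∷_; _++_; map; concatMap; upTo; drop; _∷ʳ_)
open import Data.List.Membership.Propositional using (_∈_)
open import Data.Product using (Σ; _×_; ∃)
open import Data.Bool using (if_then_else_)
open import Relation.Nullary using (¬_; yes; no)
open import Relation.Nullary.Decidable using (⌊_⌋)
open import Relation.Binary.PropositionalEquality using (_≡_)
open import Function using (_∘_)

Odd : ℕ → Set
Odd n = n % 2 ≡ 1

InRRS* : ℕ → ℕ → Set
InRRS* b r = (1 ≤ r) × (r ≤ (b ∸ 1) / 2) × (gcd r b ≡ 1)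

-- mod*(m,b): x = mod(m,b) if x ≤ b/2 (i.e. 2x ≤ b), else mod(-m,b) = b - x
-- (in the second case x > 0, so mod(-m,b) = b - x)
mod* : ℕ → (b : ℕ) → .{{_ : Data.Nat.NonZero b}} → ℕ
mod* m b = let x = m % b in if ⌊ 2 * x ≤? b ⌋ then x else b ∸ x

mdsSeq : (b : ℕ) → .{{_ : Data.Nat.NonZero b}} → ℕ → ℕ → ℕ
mdsSeq b a j = mod* (a * 2 ^ j) b

Occurs : (b : ℕ) → .{{_ : Data.Nat.NonZero b}} → ℕ → ℕ → Set
Occurs b c x = ∃ λ j → (1 ≤ j) × (mdsSeq b c j ≡ x)

-- Inputs b n as : as = (a(b,1), ..., a(b,n)) are the first n inputs of the MDS system
data Inputs (b : ℕ) .{{_ : Data.Nat.NonZero b}} : ℕ → List ℕ → Set where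
  first : Inputs b 1 (1 ∷ [])
  next  : ∀ {n as a} → Inputs b n as
        → Odd a → InRRS* b a → (∀ c → c ∈ as → ¬ Occurs b c a)
        → (∀ x → Odd x → InRRS* b x → (∀ c → c ∈ as → ¬ Occurs b c x) → a ≤ x)
        → Inputs b (suc n) (as ∷ʳ a)

IsPrimitivePeriod : (ℕ → ℕ) → ℕ → Set
IsPrimitivePeriod s p =
  (1 ≤ p) × (∀ j → 1 ≤ j → s (j + p) ≡ s j)
  × (∀ q → 1 ≤ q → q < p → ¬ (∀ j → 1 ≤ j → s (j + q) ≡ s j))

-- 2-adic valuation (fuel-bounded; the fuel n suffices for n ≥ 1)
v2-fuel : ℕ → ℕ → ℕ
v2-fuel zero n = 0
v2-fuel (suc f) zero = 0
v2-fuel (suc f) (suc n) with suc n % 2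
... | zero = suc (v2-fuel f (suc n / 2))
... | suc _ = 0

v2 : ℕ → ℕ
v2 n = v2-fuel n n

coachStep : ℕ → ℕ → ℕ
coachStep b x = _/_ (b ∸ x) (2 ^ v2 (b ∸ x)) {{m^n≢0 2 (v2 (b ∸ x))}}

iter : ℕ → (ℕ → ℕ) → ℕ → ℕ
iter zero f x = x
iter (suc n) f x = f (iter n f x)

coachA : ℕ → ℕ → ℕ → ℕ
coachA b a j = iter (j ∸ 1) (coachStep b) a

coachK : ℕ → ℕ → ℕ → ℕ
coachK b a j = v2 (b ∸ coachA b a j)

IsCoachLength : ℕ → ℕ → ℕ → Set
IsCoachLength b a r =
  (1 ≤ r) × (coachA b a (suc r) ≡ a)
  × (∀ q → 1 ≤ q → q < r → ¬ (coachA b a (suc q) ≡ a))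

cy : ℕ → ℕ → ℕ → ℕ → ℕ
cy b a r j = coachA b a (r + 2 ∸ j)

ly : ℕ → ℕ → ℕ → ℕ → ℕ
ly b a r j = coachK b a (r + 1 ∸ j)

EMCSy : ℕ → ℕ → ℕ → List ℕ
EMCSy b a r =
  concatMap (λ j → map (λ p → 2 ^ p * cy b a r (suc j)) (upTo (ly b a r (suc j)))) (upTo r)
  ++ (cy b a r 1 ∷ [])

{-# OPTIONS --safe #-}
-- Write T y = mod*(2y, b). For 2a < b, mdsSeq b a is the T-orbit of a. If x is odd with 2x < b and
-- b ∸ x = 2^k c with c odd, then c, 2c, …, 2^(k-1)c all lie below b/2, so T doubles them, and
-- T(2^(k-1)c) = mod*(b ∸ x) = x: each coach step x ↦ c is undone by exactly k steps of T.
-- Read backwards, the coach cycle therefore traces the T-orbit of a block by block, EMCSy lists one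
-- full turn of it, and since only the first entry of a block is odd, a T-return to a before the end
-- of the turn would be a return of the coach to a before step r.
module Submission where

open import Defs
open import Data.Nat
open import Data.Nat.Properties
open import Data.Nat.DivMod
open import Algebra.Properties.CommutativeSemigroup *-commutativeSemigroup using (x∙yz≈y∙xz)
open import Data.Bool using (if_then_else_)
open import Data.List using (List; []; _∷_; _++_; [_]; map; concatMap; applyUpTo; upTo; drop; iterate; _∷ʳ_)
open import Data.List.Properties using (++-identityʳ; concatMap-++; applyUpTo-∷ʳ; map-applyUpTo; ∷ʳ-injectiveʳ)
open import Data.Product using (∃; _×_; _,_; proj₁; proj₂)
open import Data.Empty using (⊥-elim)
open import Function using (id)
open import Relation.Nullary using (¬_; yes; no)
open import Relation.Nullary.Decidable using (⌊_⌋)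
open import Relation.Binary.PropositionalEquality hiding ([_])
open ≡-Reasoning

even-double : ∀ z → ¬ Odd (2 * z)
even-double z odd = 0≢1+n (trans (sym (trans (cong (_% 2) (*-comm 2 z)) (m*n%n≡0 z 2))) odd)

odd+odd-even : ∀ x y → Odd x → Odd y → ¬ Odd (x + y)
odd+odd-even x y odd-x odd-y odd-x+y = 0≢1+n (begin
  0                   ≡⟨⟩
  (1 + 1) % 2         ≡⟨ cong₂ (λ u v → (u + v) % 2) odd-x odd-y ⟨
  (x % 2 + y % 2) % 2 ≡⟨ %-distribˡ-+ x y 2 ⟨
  (x + y) % 2         ≡⟨ odd-x+y ⟩
  1                   ∎)

odd⇒0< : ∀ {x} → Odd x → 0 < x
odd⇒0< {suc x} _ = z<s

m+n≡o+o∧m<o⇒o<n : ∀ {m n o} → m + n ≡ o + o → m < o → o < n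
m+n≡o+o∧m<o⇒o<n e m<o = ≰⇒> λ n≤o → <-irrefl e (+-mono-<-≤ m<o n≤o)

m+n≡o+o∧o<m⇒n<o : ∀ {m n o} → m + n ≡ o + o → o < m → n < o
m+n≡o+o∧o<m⇒n<o e o<m = ≰⇒> λ o≤n → <-irrefl (sym e) (+-mono-<-≤ o<m o≤n)

iter-comm : ∀ n (f : ℕ → ℕ) x → iter n f (f x) ≡ f (iter n f x)
iter-comm zero    f x = refl
iter-comm (suc n) f x = cong f (iter-comm n f x)

iter-+ : ∀ m n (f : ℕ → ℕ) x → iter (m + n) f x ≡ iter n f (iter m f x)
iter-+ zero    n f x = refl
iter-+ (suc m) n f x = trans (cong f (iter-+ m n f x)) (sym (iter-comm n f (iter m f x)))

iterate-+ : ∀ (f : ℕ → ℕ) m n x → iterate f x (m + n) ≡ iterate f x m ++ iterate f (iter m f x) n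
iterate-+ f zero    n x = refl
iterate-+ f (suc m) n x = cong (x ∷_) (begin
  iterate f (f x) (m + n)                               ≡⟨ iterate-+ f m n (f x) ⟩
  iterate f (f x) m ++ iterate f (iter m f (f x)) n     ≡⟨ cong (λ y → iterate f (f x) m ++ iterate f y n) (iter-comm m f x) ⟩
  iterate f (f x) m ++ iterate f (f (iter m f x)) n     ∎)

drop-1-iterate-∷ʳ : ∀ (f : ℕ → ℕ) n x → drop 1 (iterate f x n ++ [ iter n f x ]) ≡ iterate f (f x) n
drop-1-iterate-∷ʳ f zero    x = refl
drop-1-iterate-∷ʳ f (suc n) x = begin
  iterate f (f x) n ++ [ f (iter n f x) ]  ≡⟨ cong (λ y → iterate f (f x) n ++ [ y ]) (iter-comm n f x) ⟨
  iterate f (f x) n ++ [ iter n f (f x) ]  ≡⟨ iterate-+ f n 1 (f x) ⟨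
  iterate f (f x) (n + 1)                  ≡⟨ cong (iterate f (f x)) (+-comm n 1) ⟩
  iterate f (f x) (suc n)                  ∎

applyUpTo-cong-< : ∀ {A : Set} {f g : ℕ → A} n → (∀ j → j < n → f j ≡ g j) → applyUpTo f n ≡ applyUpTo g n
applyUpTo-cong-< zero    _  = refl
applyUpTo-cong-< (suc n) eq = cong₂ _∷_ (eq 0 z<s) (applyUpTo-cong-< n λ j j<n → eq (suc j) (s<s j<n))

iterate≡applyUpTo-iter : ∀ (f : ℕ → ℕ) x n → iterate f x n ≡ applyUpTo (λ j → iter j f x) n
iterate≡applyUpTo-iter f x zero    = refl
iterate≡applyUpTo-iter f x (suc n) = cong (x ∷_) (trans (iterate≡applyUpTo-iter f (f x) n)
  (applyUpTo-cong-< n λ j _ → iter-comm j f x))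

module Chain (f : ℕ → ℕ) (x l : ℕ → ℕ) where

  offset : ℕ → ℕ
  offset zero    = 0
  offset (suc n) = offset n + l n

  Linked : ℕ → Set
  Linked n = ∀ j → j < n → iter (l j) f (x j) ≡ x (suc j)

  Linked-≤ : ∀ {m n} → m ≤ n → Linked n → Linked m
  Linked-≤ m≤n linked j j<m = linked j (<-≤-trans j<m m≤n)

  Linked-pred : ∀ {n} → Linked (suc n) → Linked n
  Linked-pred = Linked-≤ (n≤1+n _)

  0<offset : ∀ n → 0 < n → (∀ j → j < n → 0 < l j) → 0 < offset n
  0<offset (suc n) _ 0<l = <-≤-trans (0<l n ≤-refl) (m≤n+m (l n) (offset n))

  iter-offset : ∀ n → Linked n → iter (offset n) f (x 0) ≡ x n
  iter-offset zero    _      = refl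
  iter-offset (suc n) linked = begin
    iter (offset n + l n) f (x 0)           ≡⟨ iter-+ (offset n) (l n) f (x 0) ⟩
    iter (l n) f (iter (offset n) f (x 0))  ≡⟨ cong (iter (l n) f) (iter-offset n (Linked-pred linked)) ⟩
    iter (l n) f (x n)                      ≡⟨ linked n ≤-refl ⟩
    x (suc n)                               ∎

  concatMap≡iterate-offset : ∀ (B : ℕ → List ℕ) n → Linked n → (∀ j → j < n → B j ≡ iterate f (x j) (l j))
                           → concatMap B (upTo n) ≡ iterate f (x 0) (offset n)
  concatMap≡iterate-offset B zero    _      _      = refl
  concatMap≡iterate-offset B (suc n) linked blocks = begin
    concatMap B (upTo (suc n))                                ≡⟨ cong (concatMap B) (applyUpTo-∷ʳ id n) ⟨
    concatMap B (upTo n ++ [ n ])                             ≡⟨ concatMap-++ B (upTo n) [ n ] ⟩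
    concatMap B (upTo n) ++ B n ++ []                         ≡⟨ cong₂ _++_ previous (trans (++-identityʳ (B n)) (blocks n ≤-refl)) ⟩
    iterate f (x 0) (offset n) ++ iterate f (x n) (l n)       ≡⟨ cong (λ y → iterate f (x 0) (offset n) ++ iterate f y (l n)) (iter-offset n (Linked-pred linked)) ⟨
    iterate f (x 0) (offset n) ++ iterate f (iter (offset n) f (x 0)) (l n)  ≡⟨ iterate-+ f (offset n) (l n) (x 0) ⟨
    iterate f (x 0) (offset (suc n))                          ∎
    where
    previous : concatMap B (upTo n) ≡ iterate f (x 0) (offset n)
    previous = concatMap≡iterate-offset B n (Linked-pred linked) λ j j<n → blocks j (m<n⇒m<1+n j<n)

  offset-of-return : (P : ℕ → Set) → ∀ n → Linked n
    → (∀ j q → j < n → 0 < q → q < l j → ¬ P (iter q f (x j)))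
    → ∀ q → q < offset n → P (iter q f (x 0)) → ∃ λ j → j < n × q ≡ offset j
  offset-of-return P zero    _      _        q ()
  offset-of-return P (suc n) linked interior q q<offset p with q <? offset n
  ... | yes q<offset-n =
    let (j , j<n , q≡) = offset-of-return P n (Linked-pred linked) (λ j q j<n → interior j q (m<n⇒m<1+n j<n)) q q<offset-n p
    in j , m<n⇒m<1+n j<n , q≡
  ... | no q≮offset-n with m≤n⇒∃[o]m+o≡n (≮⇒≥ q≮offset-n)
  ...   | zero  , refl = n , ≤-refl , +-identityʳ (offset n)
  ...   | suc d , refl = ⊥-elim (interior n (suc d) ≤-refl z<s (+-cancelˡ-< (offset n) (suc d) (l n) q<offset)
                           (subst P (trans (iter-+ (offset n) (suc d) f (x 0))
                                           (cong (iter (suc d) f) (iter-offset n (Linked-pred linked)))) p))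

even⇒2*half : ∀ n → n % 2 ≡ 0 → n ≡ 2 * (n / 2)
even⇒2*half n rem = begin
  n                 ≡⟨ m≡m%n+[m/n]*n n 2 ⟩
  n % 2 + n / 2 * 2 ≡⟨ cong (_+ n / 2 * 2) rem ⟩
  n / 2 * 2         ≡⟨ *-comm (n / 2) 2 ⟩
  2 * (n / 2)       ∎

even⇒2≤ : ∀ n → n % 2 ≡ 0 → 0 < n → 2 ≤ n
even⇒2≤ (suc zero)    ()  _
even⇒2≤ (suc (suc n)) _   _ = s≤s (s≤s z≤n)

v2-fuel-spec : ∀ fuel n → 0 < n → n ≤ fuel → ∃ λ o → Odd o × n ≡ 2 ^ v2-fuel fuel n * o
v2-fuel-spec (suc fuel) (suc n) _ (s≤s n≤fuel) with suc n % 2 in rem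
... | suc zero    = suc n , rem , sym (+-identityʳ (suc n))
... | suc (suc _) = ⊥-elim (<-irrefl rem (<-≤-trans (m%n<n (suc n) 2) (s≤s (s≤s z≤n))))
... | zero
  with o , odd-o , half≡ ← v2-fuel-spec fuel (suc n / 2) (m≥n⇒m/n>0 (even⇒2≤ (suc n) rem z<s))
                             (≤-trans (s≤s⁻¹ (m/n<m (suc n) 2 (s≤s (s≤s z≤n)))) n≤fuel)
  = o , odd-o , (begin
    suc n                                  ≡⟨ even⇒2*half (suc n) rem ⟩
    2 * (suc n / 2)                        ≡⟨ cong (2 *_) half≡ ⟩
    2 * (2 ^ v2-fuel fuel (suc n / 2) * o) ≡⟨ *-assoc 2 (2 ^ v2-fuel fuel (suc n / 2)) o ⟨
    2 ^ suc (v2-fuel fuel (suc n / 2)) * o ∎)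

v2-spec : ∀ n → 0 < n → ∃ λ o → Odd o × n ≡ 2 ^ v2 n * o
v2-spec n 0<n = v2-fuel-spec n n 0<n ≤-refl

r+2∸[1+j]≡1+[r∸j] : ∀ r j → j ≤ r → r + 2 ∸ suc j ≡ suc (r ∸ j)
r+2∸[1+j]≡1+[r∸j] r j j≤r = trans (cong (_∸ suc j) (+-comm r 2)) (+-∸-assoc 1 j≤r)

r+1∸[1+j]≡r∸j : ∀ r j → r + 1 ∸ suc j ≡ r ∸ j
r+1∸[1+j]≡r∸j r j = cong (_∸ suc j) (+-comm r 1)

module Doubling (b : ℕ) .{{_ : NonZero b}} (odd-b : Odd b) where

  double* : ℕ → ℕ
  double* y = mod* (2 * y) b

  2*≢b : ∀ y → 2 * y ≢ b
  2*≢b y 2y≡b = even-double y (subst Odd (sym 2y≡b) odd-b)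

  2*≮b⇒b<2* : ∀ y → ¬ 2 * y < b → b < 2 * y
  2*≮b⇒b<2* y 2y≮b = ≤∧≢⇒< (≮⇒≥ 2y≮b) (λ b≡2y → 2*≢b y (sym b≡2y))

  complement-sum : ∀ y → y ≤ b → 2 * y + 2 * (b ∸ y) ≡ b + b
  complement-sum y y≤b = begin
    2 * y + 2 * (b ∸ y) ≡⟨ *-distribˡ-+ 2 y (b ∸ y) ⟨
    2 * (y + (b ∸ y))   ≡⟨ cong (2 *_) (m+[n∸m]≡n y≤b) ⟩
    2 * b               ≡⟨ cong (b +_) (+-identityʳ b) ⟩
    b + b               ∎

  complement-large : ∀ y → y ≤ b → 2 * y < b → b < 2 * (b ∸ y)
  complement-large y y≤b = m+n≡o+o∧m<o⇒o<n (complement-sum y y≤b)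

  complement-small : ∀ y → y ≤ b → b < 2 * y → 2 * (b ∸ y) < b
  complement-small y y≤b = m+n≡o+o∧o<m⇒n<o (complement-sum y y≤b)

  mod*-small : ∀ y → 2 * y < b → mod* y b ≡ y
  mod*-small y 2y<b rewrite m<n⇒m%n≡m (≤-<-trans (m≤n*m y 2) 2y<b) with 2 * y ≤? b
  ... | yes _    = refl
  ... | no 2y≰b = ⊥-elim (2y≰b (<⇒≤ 2y<b))

  mod*-large : ∀ y → y < b → b < 2 * y → mod* y b ≡ b ∸ y
  mod*-large y y<b b<2y rewrite m<n⇒m%n≡m y<b with 2 * y ≤? b
  ... | yes 2y≤b = ⊥-elim (<⇒≱ b<2y 2y≤b)
  ... | no _     = refl

  mod*-cong : ∀ m n → m % b ≡ n % b → mod* m b ≡ mod* n b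
  mod*-cong m n = cong (λ x → if ⌊ 2 * x ≤? b ⌋ then x else b ∸ x)

  mod*-complement : ∀ y → 0 < y → y < b → mod* (b ∸ y) b ≡ mod* y b
  mod*-complement y 0<y y<b with 2 * y <? b
  ... | yes 2y<b = begin
    mod* (b ∸ y) b ≡⟨ mod*-large (b ∸ y) (∸-monoʳ-< 0<y (<⇒≤ y<b)) (complement-large y (<⇒≤ y<b) 2y<b) ⟩
    b ∸ (b ∸ y)    ≡⟨ m∸[m∸n]≡n (<⇒≤ y<b) ⟩
    y              ≡⟨ mod*-small y 2y<b ⟨
    mod* y b       ∎
  ... | no 2y≮b = begin
    mod* (b ∸ y) b ≡⟨ mod*-small (b ∸ y) (complement-small y (<⇒≤ y<b) (2*≮b⇒b<2* y 2y≮b)) ⟩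
    b ∸ y          ≡⟨ mod*-large y y<b (2*≮b⇒b<2* y 2y≮b) ⟨
    mod* y b       ∎

  -- If b < 2y then, with z = 2y ∸ b, 2y ≡ z (mod b) and 2(b ∸ y) = b ∸ z, so both sides equal mod* z.
  mod*-double-< : ∀ y → y < b → mod* (2 * y) b ≡ double* (mod* y b)
  mod*-double-< y y<b with 2 * y <? b
  ... | yes 2y<b = cong double* (sym (mod*-small y 2y<b))
  ... | no 2y≮b = begin
    mod* (2 * y) b       ≡⟨ mod*-cong (2 * y) z (trans (cong (_% b) (sym z+b≡2y)) ([m+n]%n≡m%n z b)) ⟩
    mod* z b             ≡⟨ mod*-complement z (m<n⇒0<n∸m b<2y) z<b ⟨
    mod* (b ∸ z) b       ≡⟨ cong (λ u → mod* u b) 2[b∸y]≡b∸z ⟨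
    double* (b ∸ y)      ≡⟨ cong double* (mod*-large y y<b b<2y) ⟨
    double* (mod* y b)   ∎
    where
    b<2y : b < 2 * y
    b<2y = 2*≮b⇒b<2* y 2y≮b
    z : ℕ
    z = 2 * y ∸ b
    z+b≡2y : z + b ≡ 2 * y
    z+b≡2y = m∸n+n≡m (<⇒≤ b<2y)
    z<b : z < b
    z<b = +-cancelʳ-< b z b (subst (_< b + b) (sym z+b≡2y)
            (subst (2 * y <_) (cong (b +_) (+-identityʳ b)) (*-monoʳ-< 2 y<b)))
    2[b∸y]≡b∸z : 2 * (b ∸ y) ≡ b ∸ z
    2[b∸y]≡b∸z = begin
      2 * (b ∸ y)               ≡⟨ m+n∸m≡n z (2 * (b ∸ y)) ⟨
      z + 2 * (b ∸ y) ∸ z       ≡⟨ cong (_∸ z) (+-cancelʳ-≡ b _ b (begin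
        z + 2 * (b ∸ y) + b     ≡⟨ +-assoc z _ b ⟩
        z + (2 * (b ∸ y) + b)   ≡⟨ cong (z +_) (+-comm _ b) ⟩
        z + (b + 2 * (b ∸ y))   ≡⟨ +-assoc z b _ ⟨
        z + b + 2 * (b ∸ y)     ≡⟨ cong (_+ 2 * (b ∸ y)) z+b≡2y ⟩
        2 * y + 2 * (b ∸ y)     ≡⟨ complement-sum y (<⇒≤ y<b) ⟩
        b + b                   ∎)) ⟩
      b ∸ z                     ∎

  mod*-double : ∀ m → mod* (2 * m) b ≡ double* (mod* m b)
  mod*-double m = begin
    mod* (2 * m) b            ≡⟨ mod*-cong (2 * m) (2 * (m % b)) 2m≡2[m%b] ⟩
    mod* (2 * (m % b)) b      ≡⟨ mod*-double-< (m % b) (m%n<n m b) ⟩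
    double* (mod* (m % b) b)  ≡⟨ cong double* (mod*-cong (m % b) m (m%n%n≡m%n m b)) ⟩
    double* (mod* m b)        ∎
    where
    2m≡2[m%b] : (2 * m) % b ≡ (2 * (m % b)) % b
    2m≡2[m%b] = trans (%-distribˡ-* 2 m b)
      (trans (cong (λ u → ((2 % b) * u) % b) (sym (m%n%n≡m%n m b))) (sym (%-distribˡ-* 2 (m % b) b)))

  mdsSeq≡iter : ∀ a → 2 * a < b → ∀ j → mdsSeq b a j ≡ iter j double* a
  mdsSeq≡iter a 2a<b zero    = trans (cong (λ u → mod* u b) (*-identityʳ a)) (mod*-small a 2a<b)
  mdsSeq≡iter a 2a<b (suc j) = begin
    mod* (a * (2 * 2 ^ j)) b    ≡⟨ cong (λ u → mod* u b) (x∙yz≈y∙xz a 2 (2 ^ j)) ⟩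
    mod* (2 * (a * 2 ^ j)) b    ≡⟨ mod*-double (a * 2 ^ j) ⟩
    double* (mdsSeq b a j)      ≡⟨ cong double* (mdsSeq≡iter a 2a<b j) ⟩
    double* (iter j double* a)  ∎

  OddLowHalf : ℕ → Set
  OddLowHalf x = Odd x × 2 * x < b

  coachStep-odd-part : ∀ x {o} → b ∸ x ≡ 2 ^ v2 (b ∸ x) * o → coachStep b x ≡ o
  coachStep-odd-part x {o} b∸x≡ = begin
    _/_ (b ∸ x) (2 ^ k) {{m^n≢0 2 k}}  ≡⟨ cong (λ n → _/_ n (2 ^ k) {{m^n≢0 2 k}}) (trans b∸x≡ (*-comm (2 ^ k) o)) ⟩
    _/_ (o * 2 ^ k) (2 ^ k) {{m^n≢0 2 k}} ≡⟨ m*n/n≡m o (2 ^ k) {{m^n≢0 2 k}} ⟩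
    o                                 ∎
    where
    k : ℕ
    k = v2 (b ∸ x)

  module CoachBlock (x : ℕ) (x-ok : OddLowHalf x) where
    k : ℕ
    k = v2 (b ∸ x)

    c : ℕ
    c = coachStep b x

    x<b : x < b
    x<b = ≤-<-trans (m≤n*m x 2) (proj₂ x-ok)

    coachStep-spec : Odd c × b ∸ x ≡ 2 ^ k * c
    coachStep-spec with o , odd-o , b∸x≡ ← v2-spec (b ∸ x) (m<n⇒0<n∸m x<b)
      rewrite coachStep-odd-part x b∸x≡ = odd-o , b∸x≡

    odd-c : Odd c
    odd-c = proj₁ coachStep-spec

    b∸x≡ : b ∸ x ≡ 2 ^ k * c
    b∸x≡ = proj₂ coachStep-spec

    exponent-positive : ∀ {n} → b ∸ x ≡ 2 ^ n * c → 0 < n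
    exponent-positive {zero}  b∸x≡c = ⊥-elim (odd+odd-even x (b ∸ x) (proj₁ x-ok)
      (subst Odd (sym (trans b∸x≡c (*-identityˡ c))) odd-c)
      (subst Odd (sym (m+[n∸m]≡n (<⇒≤ x<b))) odd-b))
    exponent-positive {suc n} _ = z<s

    0<k : 0 < k
    0<k = exponent-positive b∸x≡

    pow<b : ∀ q → q ≤ k → 2 ^ q * c < b
    pow<b q q≤k = ≤-<-trans (subst (2 ^ q * c ≤_) (sym b∸x≡) (*-monoˡ-≤ c (^-monoʳ-≤ 2 q≤k)))
                            (∸-monoʳ-< (odd⇒0< (proj₁ x-ok)) (<⇒≤ x<b))

    coachStep-OddLowHalf : OddLowHalf c
    coachStep-OddLowHalf = odd-c , pow<b 1 0<k

    iter-double*-block : ∀ q → q < k → iter q double* c ≡ 2 ^ q * c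
    iter-double*-block zero    _      = sym (*-identityˡ c)
    iter-double*-block (suc q) 1+q<k = begin
      double* (iter q double* c) ≡⟨ cong double* (iter-double*-block q (<-trans (n<1+n q) 1+q<k)) ⟩
      mod* (2 * (2 ^ q * c)) b   ≡⟨ cong (λ u → mod* u b) (*-assoc 2 (2 ^ q) c) ⟨
      mod* (2 ^ suc q * c) b     ≡⟨ mod*-small (2 ^ suc q * c) (subst (_< b) (*-assoc 2 (2 ^ suc q) c) (pow<b (suc (suc q)) 1+q<k)) ⟩
      2 ^ suc q * c              ∎

    iter-double*-k : iter k double* c ≡ x
    iter-double*-k = begin
      iter k double* c                    ≡⟨ cong (λ n → iter n double* c) k≡1+k′ ⟨
      double* (iter k′ double* c)         ≡⟨ cong double* (iter-double*-block k′ (subst (k′ <_) k≡1+k′ ≤-refl)) ⟩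
      mod* (2 * (2 ^ k′ * c)) b           ≡⟨ cong (λ u → mod* u b) (trans (sym (*-assoc 2 (2 ^ k′) c)) (cong (λ n → 2 ^ n * c) k≡1+k′)) ⟩
      mod* (2 ^ k * c) b                  ≡⟨ cong (λ u → mod* u b) b∸x≡ ⟨
      mod* (b ∸ x) b                      ≡⟨ mod*-complement x (odd⇒0< (proj₁ x-ok)) x<b ⟩
      mod* x b                            ≡⟨ mod*-small x (proj₂ x-ok) ⟩
      x                                   ∎
      where
      k′ : ℕ
      k′ = pred k
      k≡1+k′ : suc k′ ≡ k
      k≡1+k′ = suc-pred k {{>-nonZero 0<k}}

    block-interior-even : ∀ q → 0 < q → q < k → ¬ Odd (iter q double* c)
    block-interior-even (suc q) _ 1+q<k odd = even-double (2 ^ q * c)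
      (subst Odd (trans (iter-double*-block (suc q) 1+q<k) (*-assoc 2 (2 ^ q) c)) odd)

    iterate-block : iterate double* c k ≡ map (λ p → 2 ^ p * c) (upTo k)
    iterate-block = begin
      iterate double* c k                        ≡⟨ iterate≡applyUpTo-iter double* c k ⟩
      applyUpTo (λ q → iter q double* c) k       ≡⟨ applyUpTo-cong-< k iter-double*-block ⟩
      applyUpTo (λ q → 2 ^ q * c) k              ≡⟨ map-applyUpTo id (λ q → 2 ^ q * c) k ⟨
      map (λ q → 2 ^ q * c) (upTo k)             ∎

  inputs-OddLowHalf : 3 ≤ b → ∀ {i xs} → Inputs b i xs → ∀ as a → xs ≡ as ∷ʳ a → OddLowHalf a
  inputs-OddLowHalf 3≤b first as a xs≡ with refl ← ∷ʳ-injectiveʳ [] as xs≡ = refl , 3≤b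
  inputs-OddLowHalf 3≤b (next {as = as′} _ odd-a (_ , a≤[b∸1]/2 , _) _ _) as a xs≡
    with refl ← ∷ʳ-injectiveʳ as′ as xs≡ = odd-a , ≤-<-trans 2a≤b∸1 (∸-monoʳ-< z<s (≤-trans (s≤s z≤n) 3≤b))
    where
    2a≤b∸1 : 2 * a ≤ b ∸ 1
    2a≤b∸1 = ≤-trans (*-monoʳ-≤ 2 a≤[b∸1]/2) (subst (_≤ b ∸ 1) (*-comm ((b ∸ 1) / 2) 2) (m/n*n≤m (b ∸ 1) 2))

  iter-coachStep-OddLowHalf : ∀ a → OddLowHalf a → ∀ j → OddLowHalf (iter j (coachStep b) a)
  iter-coachStep-OddLowHalf a a-ok zero    = a-ok
  iter-coachStep-OddLowHalf a a-ok (suc j) =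
    CoachBlock.coachStep-OddLowHalf (iter j (coachStep b) a) (iter-coachStep-OddLowHalf a a-ok j)

  module Orbit (a : ℕ) (2a<b : 2 * a < b) where

    map-mdsSeq≡iterate : ∀ p → map (λ j → mdsSeq b a (suc j)) (upTo p) ≡ iterate double* (double* a) p
    map-mdsSeq≡iterate p = begin
      map (λ j → mdsSeq b a (suc j)) (upTo p)         ≡⟨ map-applyUpTo id (λ j → mdsSeq b a (suc j)) p ⟩
      applyUpTo (λ j → mdsSeq b a (suc j)) p          ≡⟨ applyUpTo-cong-< p (λ j _ → trans (mdsSeq≡iter a 2a<b (suc j)) (sym (iter-comm j double* a))) ⟩
      applyUpTo (λ j → iter j double* (double* a)) p  ≡⟨ iterate≡applyUpTo-iter double* (double* a) p ⟨
      iterate double* (double* a) p                   ∎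

    module _ (K : ℕ) (closes : iter K double* a ≡ a) where

      iter-+-period : ∀ j → iter (K + j) double* a ≡ iter j double* a
      iter-+-period j = trans (iter-+ K j double* a) (cong (iter j double*) closes)

      mdsSeq-periodic : ∀ j → mdsSeq b a (j + K) ≡ mdsSeq b a j
      mdsSeq-periodic j = begin
        mdsSeq b a (j + K)        ≡⟨ mdsSeq≡iter a 2a<b (j + K) ⟩
        iter (j + K) double* a    ≡⟨ cong (λ n → iter n double* a) (+-comm j K) ⟩
        iter (K + j) double* a    ≡⟨ iter-+-period j ⟩
        iter j double* a          ≡⟨ mdsSeq≡iter a 2a<b j ⟨
        mdsSeq b a j              ∎

      mdsSeq-period⇒return : 0 < K → ∀ q → (∀ j → 1 ≤ j → mdsSeq b a (j + q) ≡ mdsSeq b a j) → iter q double* a ≡ a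
      mdsSeq-period⇒return 0<K q periodic-q = begin
        iter q double* a          ≡⟨ iter-+-period q ⟨
        iter (K + q) double* a    ≡⟨ mdsSeq≡iter a 2a<b (K + q) ⟨
        mdsSeq b a (K + q)        ≡⟨ periodic-q K 0<K ⟩
        mdsSeq b a K              ≡⟨ mdsSeq≡iter a 2a<b K ⟩
        iter K double* a          ≡⟨ closes ⟩
        a                         ∎

  module CoachCycle (a r : ℕ) (a-ok : OddLowHalf a) (coach-length : IsCoachLength b a r) where

    0<r : 0 < r
    0<r = proj₁ coach-length

    coach-closes : coachA b a (suc r) ≡ a
    coach-closes = proj₁ (proj₂ coach-length)

    coach-minimal : ∀ q → 1 ≤ q → q < r → coachA b a (suc q) ≢ a
    coach-minimal = proj₂ (proj₂ coach-length)

    x : ℕ → ℕ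
    x j = cy b a r (suc j)

    l : ℕ → ℕ
    l j = ly b a r (suc j)

    B : ℕ → List ℕ
    B j = map (λ p → 2 ^ p * cy b a r (suc j)) (upTo (ly b a r (suc j)))

    open Chain double* x l

    x≡coachA : ∀ j → j ≤ r → x j ≡ coachA b a (suc (r ∸ j))
    x≡coachA j j≤r = cong (coachA b a) (r+2∸[1+j]≡1+[r∸j] r j j≤r)

    module Link (j : ℕ) (j<r : j < r) where
      m : ℕ
      m = r ∸ suc j

      open CoachBlock (coachA b a (suc m)) (iter-coachStep-OddLowHalf a a-ok m) public

      x≡c : x j ≡ c
      x≡c = trans (x≡coachA j (<⇒≤ j<r)) (cong (λ n → coachA b a (suc n)) (+-∸-assoc 1 j<r))

      l≡k : l j ≡ k
      l≡k = cong (coachK b a) (trans (r+1∸[1+j]≡r∸j r j) (+-∸-assoc 1 j<r))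

    linked : Linked r
    linked j j<r = begin
      iter (l j) double* (x j)  ≡⟨ cong₂ (λ n y → iter n double* y) l≡k x≡c ⟩
      iter k double* c          ≡⟨ iter-double*-k ⟩
      coachA b a (suc m)        ≡⟨ x≡coachA (suc j) j<r ⟨
      x (suc j)                 ∎
      where open Link j j<r

    blocks : ∀ j → j < r → B j ≡ iterate double* (x j) (l j)
    blocks j j<r = begin
      map (λ p → 2 ^ p * x j) (upTo (l j))  ≡⟨ cong₂ (λ y n → map (λ p → 2 ^ p * y) (upTo n)) x≡c l≡k ⟩
      map (λ p → 2 ^ p * c) (upTo k)        ≡⟨ iterate-block ⟨
      iterate double* c k                   ≡⟨ cong₂ (iterate double*) x≡c l≡k ⟨
      iterate double* (x j) (l j)           ∎
      where open Link j j<r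

    0<l : ∀ j → j < r → 0 < l j
    0<l j j<r = subst (0 <_) (sym l≡k) 0<k
      where open Link j j<r

    interior-even : ∀ j q → j < r → 0 < q → q < l j → ¬ Odd (iter q double* (x j))
    interior-even j q j<r 0<q q<l odd =
      block-interior-even q 0<q (subst (q <_) l≡k q<l) (subst (λ y → Odd (iter q double* y)) x≡c odd)
      where open Link j j<r

    x0≡a : x 0 ≡ a
    x0≡a = trans (x≡coachA 0 z≤n) coach-closes

    xr≡a : x r ≡ a
    xr≡a = trans (x≡coachA r ≤-refl) (cong (λ n → coachA b a (suc n)) (n∸n≡0 r))

    K : ℕ
    K = offset r

    0<K : 0 < K
    0<K = 0<offset r 0<r 0<l

    cycle-closes : iter K double* a ≡ a
    cycle-closes = begin
      iter K double* a      ≡⟨ cong (iter K double*) x0≡a ⟨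
      iter K double* (x 0)  ≡⟨ iter-offset r linked ⟩
      x r                   ≡⟨ xr≡a ⟩
      a                     ∎

    EMCSy≡iterate : EMCSy b a r ≡ iterate double* a K ++ [ a ]
    EMCSy≡iterate = cong₂ (λ y z → y ++ [ z ])
      (trans (concatMap≡iterate-offset B r linked blocks) (cong (λ y → iterate double* y K) x0≡a)) x0≡a

    no-early-return : ∀ q → 0 < q → q < K → iter q double* a ≢ a
    no-early-return q 0<q q<K returns
      with offset-of-return Odd r linked interior-even q q<K
             (subst Odd (sym (trans (cong (iter q double*) x0≡a) returns)) (proj₁ a-ok))
    ... | zero  , _   , refl = <-irrefl refl 0<q
    ... | suc j , j<r , refl = coach-minimal (r ∸ suc j) (m<n⇒0<n∸m j<r) (∸-monoʳ-< z<s (<⇒≤ j<r)) (begin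
      coachA b a (suc (r ∸ suc j))        ≡⟨ x≡coachA (suc j) (<⇒≤ j<r) ⟨
      x (suc j)                           ≡⟨ iter-offset (suc j) (Linked-≤ (<⇒≤ j<r) linked) ⟨
      iter (offset (suc j)) double* (x 0) ≡⟨ cong (iter (offset (suc j)) double*) x0≡a ⟩
      iter (offset (suc j)) double* a     ≡⟨ returns ⟩
      a                                   ∎)

proposition32 : (b : ℕ) → .{{_ : NonZero b}} → (i : ℕ) → (as : List ℕ) → (a r : ℕ)
    → Odd b → 3 ≤ b
    → Inputs b i (as ∷ʳ a)
    → IsCoachLength b a r
    → ∃ λ p → IsPrimitivePeriod (mdsSeq b a) p
        × (drop 1 (EMCSy b a r) ≡ map (λ j → mdsSeq b a (suc j)) (upTo p))
proposition32 b i as a r odd-b 3≤b inputs coach-length =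
  K , (0<K , (λ j _ → mdsSeq-periodic K cycle-closes j) , no-shorter-period) , EMCSy-tail
  where
  open Doubling b odd-b
  a-ok : OddLowHalf a
  a-ok = inputs-OddLowHalf 3≤b inputs as a refl
  open CoachCycle a r a-ok coach-length
  open Orbit a (proj₂ a-ok)

  no-shorter-period : ∀ q → 1 ≤ q → q < K → ¬ (∀ j → 1 ≤ j → mdsSeq b a (j + q) ≡ mdsSeq b a j)
  no-shorter-period q 0<q q<K periodic-q = no-early-return q 0<q q<K (mdsSeq-period⇒return K cycle-closes 0<K q periodic-q)

  EMCSy-tail : drop 1 (EMCSy b a r) ≡ map (λ j → mdsSeq b a (suc j)) (upTo K)
  EMCSy-tail = begin
    drop 1 (EMCSy b a r)                             ≡⟨ cong (drop 1) EMCSy≡iterate ⟩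
    drop 1 (iterate double* a K ++ [ a ])            ≡⟨ cong (λ y → drop 1 (iterate double* a K ++ [ y ])) cycle-closes ⟨
    drop 1 (iterate double* a K ++ [ iter K double* a ]) ≡⟨ drop-1-iterate-∷ʳ double* K a ⟩
    iterate double* (double* a) K                    ≡⟨ map-mdsSeq≡iterate K ⟨
    map (λ j → mdsSeq b a (suc j)) (upTo K)          ∎
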